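{- Let $G_{bip}=(A,B;E)$ be an undirected bipartite graph, let $n=|A|+|B|$, and let $A_{\mathrm{rest}},B_{\mathrm{rest}}$ be the leftover sets produced by the procedure FindBicliques (described in the context) on $G_{bip}$. Let $V_{\mathrm{rest}}=A_{\mathrm{rest}}\cup B_{\mathrm{rest}}$ and $E_{\mathrm{rest}}=E\cap(A_{\mathrm{rest}}\times B_{\mathrm{rest}})$. Then there exists a function $N_{\mathrm{rest}}:V_{\mathrm{rest}}\to\mathcal{P}(V_{\mathrm{rest}})$ such that for every edge $(u,v)\in E_{\mathrm{rest}}$ we have $u\in N_{\mathrm{rest}}(v)$ or $v\in N_{\mathrm{rest}}(u)$, and $|N_{\mathrm{rest}}(u)|=\mathcal{O}(n/\log^3 n)$ for every $u\in V_{\mathrm{rest}}$.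
   Context: Procedure FindBicliques on $G_{bip}=(A,B;E)$ with $n=|A|+|B|$: set $G_1=G_{bip}$, $i=1$. While the current graph $G_i=(A^i,B^i;E^i)$ satisfies $w:=|A^i|+|B^i|>\max(c_{\min},n^{3/4})$ and $|E^i|>w^2/\log^6 w$, find a biclique $K_i=(A_i,B_i;A_i\times B_i)$ contained in $G_i$ with $A_i\subseteq A^i$, $B_i\subseteq B^i$, $|A_i|=|B_i|=q$, where $q=\Theta(\log w/\log(w^2/|E^i|))$ (such a biclique exists by a theorem of Mubayi and Turán, which states that there is an absolute constant $c_{\min}$ such that every graph on $w\ge c_{\min}$ vertices with at least $8w^{3/2}$ edges contains $K_{q,q}$ with $q=\Theta(\log w/\log(w^2/|E|))$; the constants in $\Theta$ are absolute); then let $G_{i+1}$ be obtained from $G_i$ by deleting the nodes of $A_i\cup B_i$ and their incident edges, and increase $i$. When the loop stops, set $A_{\mathrm{rest}}=A^i$ and $B_{\mathrm{rest}}=B^i$. Logarithms are base 2. -}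

module Defs where

open import Data.Nat using (ℕ; zero; suc; _+_; _*_; _^_; _≤_; _<_)
open import Data.Nat.Logarithm using (⌊log₂_⌋)
open import Data.Bool using (Bool; true; false; _∧_; if_then_else_)
open import Data.Fin using (Fin)
open import Data.Fin.Subset using (Subset; ∣_∣; _∈_; _⊆_; _─_; ⊤)
open import Data.Vec using (lookup)
open import Data.List using (allFin; map)
open import Data.Nat.ListAction using (sum)
open import Data.Product using (Σ; ∃; _×_; _,_; proj₁; proj₂)
open import Data.Sum using (_⊎_; inj₁; inj₂)
open import Relation.Nullary using (¬_)
open import Relation.Binary.PropositionalEquality using (_≡_)

-- A bipartite graph G = (A, B; E) with A = Fin a, B = Fin b and
-- edge indicator E i j (true iff {i , j} is an edge, i ∈ A, j ∈ B).
BipEdges : ℕ → ℕ → Set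
BipEdges a b = Fin a → Fin b → Bool

-- A state of the procedure: the current vertex sets (A^i , B^i).
State : ℕ → ℕ → Set
State a b = Subset a × Subset b

width : ∀ {a b} → State a b → ℕ
width (SA , SB) = ∣ SA ∣ + ∣ SB ∣

edgeCount : ∀ {a b} → BipEdges a b → State a b → ℕ
edgeCount {a} {b} E (SA , SB) =
  sum (map (λ i → sum (map (λ j →
    if lookup SA i ∧ lookup SB j ∧ E i j then 1 else 0) (allFin b))) (allFin a))

-- The real inequality  m > w² / log₂⁶ w  (m = number of edges, log base 2,
-- real logarithm).  For real x = (w²/m)^{1/6} ≥ 0 it is equivalent to
-- x < log₂ w, i.e. to the existence of a rational r = p/q (q ≥ 1) with
-- x < r < log₂ w, i.e.  w² q⁶ < p⁶ m  and  2^p < w^q.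
-- (For m = 0 or w ≤ 1 both sides are false, as intended.)
ManyEdges : ℕ → ℕ → Set
ManyEdges w m = Σ ℕ λ p → Σ ℕ λ q →
  (1 ≤ q) × (w ^ 2 * q ^ 6 < p ^ 6 * m) × (2 ^ p < w ^ q)

-- Loop condition of FindBicliques, with n = |A| + |B|:
--   w > max(c_min , n^{3/4})  (i.e. w > c_min and w⁴ > n³)
--   and |E^i| > w² / log⁶ w.
Continue : ∀ {a b} → ℕ → BipEdges a b → State a b → Set
Continue {a} {b} cmin E s =
  (cmin < width s) × ((a + b) ^ 3 < width s ^ 4) × ManyEdges (width s) (edgeCount E s)

Step : ∀ {a b} → BipEdges a b → State a b → State a b → Set
Step {a} {b} E (SA , SB) t =
  Σ (Subset a) λ Ai → Σ (Subset b) λ Bi →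
    (Ai ⊆ SA) × (Bi ⊆ SB) × (∣ Ai ∣ ≡ ∣ Bi ∣) ×
    (∀ i j → i ∈ Ai → j ∈ Bi → E i j ≡ true) ×
    (t ≡ (SA ─ Ai , SB ─ Bi))

data Run {a b : ℕ} (cmin : ℕ) (E : BipEdges a b) : State a b → State a b → Set where
  stop : ∀ {s} → ¬ Continue cmin E s → Run cmin E s s
  step : ∀ {s s′ t} → Continue cmin E s → Step E s s′ → Run cmin E s′ t → Run cmin E s t

FindBicliques : ∀ {a b} → ℕ → BipEdges a b → Subset a → Subset b → Set
FindBicliques cmin E Arest Brest = Run cmin E (⊤ , ⊤) (Arest , Brest)

Vertex : ℕ → ℕ → Set
Vertex a b = Fin a ⊎ Fin b

VSet : ℕ → ℕ → Set
VSet a b = Subset a × Subset b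

_∈V_ : ∀ {a b} → Vertex a b → VSet a b → Set
inj₁ i ∈V (X , Y) = i ∈ X
inj₂ j ∈V (X , Y) = j ∈ Y

_⊆V_ : ∀ {a b} → VSet a b → VSet a b → Set
(X , Y) ⊆V (X′ , Y′) = (X ⊆ X′) × (Y ⊆ Y′)

∣_∣V : ∀ {a b} → VSet a b → ℕ
∣ X , Y ∣V = ∣ X ∣ + ∣ Y ∣

-- Orient every leftover edge towards its A-endpoint if that endpoint is heavy
-- (degree above n / log³ n) and towards its B-endpoint otherwise.  Light
-- vertices then have O(n / log³ n) out-neighbours by definition, and every
-- B-vertex points to the heavy set H.  Counting edges gives |H| · n ≤ |E_rest| log³ n,
-- and since the loop has halted one of its three conditions fails: the graph is
-- of bounded size, or has at most n^{3/4} vertices (and log¹² n = O(n)), or has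
-- at most O(w² / log⁶ n) edges.  In each case |H| = O(n / log³ n).
module Submission where

open import Defs
open import Data.Bool using (Bool; true; false; _∧_; if_then_else_)
open import Data.Fin using (Fin; zero; suc)
open import Data.Fin.Subset using (Subset; ∣_∣; _∈_; _⊆_; ⊥)
open import Data.Fin.Subset.Properties using (⊥⊆; ∣⊥∣≡0; ∣p∣≤n; p⊆q⇒∣p∣≤∣q∣)
open import Data.List as List using (List; []; _∷_; allFin; map)
open import Data.List.Properties using (map-tabulate; tabulate-cong)
open import Data.Nat
open import Data.Nat.ListAction using (sum)
open import Data.Nat.Logarithm using (⌊log₂_⌋; ⌊log₂⌋-mono-≤; ⌊log₂⌊n/2⌋⌋≡⌊log₂n⌋∸1)
open import Data.Nat.Properties
open import Data.Nat.DivMod using (_/_; _%_; m≡m%n+[m/n]*n; m%n<n; m/n*n≤m)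
open import Data.Nat.Solver using (module +-*-Solver)
open import Data.Product using (Σ; _×_; _,_)
open import Data.Sum using (_⊎_; inj₁; inj₂)
open import Data.Vec as Vec using (lookup; _∷_)
open import Data.Vec.Properties using (lookup∘tabulate; lookup⇒[]=; []=⇒lookup)
open import Relation.Binary.PropositionalEquality
open import Relation.Nullary using (¬_; yes; no; contradiction)
open import Relation.Nullary.Reflects using (Reflects; ofʸ; ofⁿ)

open +-*-Solver using (solve; _:=_; _:*_; _:^_; con)

n<2^n : ∀ n → n < 2 ^ n
n<2^n zero    = z<s
n<2^n (suc n) = begin-strict
  suc n          <⟨ +-monoʳ-< 1 (n<2^n n) ⟩
  1 + 2 ^ n      ≤⟨ +-monoˡ-≤ (2 ^ n) (m^n>0 2 n) ⟩
  2 ^ n + 2 ^ n  ≡⟨ cong (2 ^ n +_) (+-identityʳ (2 ^ n)) ⟨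
  2 ^ suc n      ∎
  where open ≤-Reasoning

^-distrib-* : ∀ m n k → (m * n) ^ k ≡ m ^ k * n ^ k
^-distrib-* m n zero    = refl
^-distrib-* m n (suc k) = begin
  m * n * (m * n) ^ k        ≡⟨ cong (m * n *_) (^-distrib-* m n k) ⟩
  m * n * (m ^ k * n ^ k)    ≡⟨ solve 4 (λ m n x y → m :* n :* (x :* y) := m :* x :* (n :* y))
                                       refl m n (m ^ k) (n ^ k) ⟩
  m * m ^ k * (n * n ^ k)    ∎
  where open ≡-Reasoning

^-cancelˡ-≤ : ∀ k .{{_ : NonZero k}} {m n} → m ^ k ≤ n ^ k → m ≤ n
^-cancelˡ-≤ k {m} {n} mᵏ≤nᵏ with m ≤? n
... | yes m≤n = m≤n
... | no  m≰n = contradiction mᵏ≤nᵏ (<⇒≱ (^-monoˡ-< k (≰⇒> m≰n)))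

m^k≤k^k*2^m : ∀ k .{{_ : NonZero k}} m → m ^ k ≤ k ^ k * 2 ^ m
m^k≤k^k*2^m k m = begin
  m ^ k                    ≤⟨ ^-monoˡ-≤ k m≤2ᵗk ⟩
  (2 ^ t * k) ^ k          ≡⟨ ^-distrib-* (2 ^ t) k k ⟩
  (2 ^ t) ^ k * k ^ k      ≡⟨ cong (_* k ^ k) (^-*-assoc 2 t k) ⟩
  2 ^ (t * k) * k ^ k      ≤⟨ *-monoˡ-≤ (k ^ k) (^-monoʳ-≤ 2 (m/n*n≤m m k)) ⟩
  2 ^ m * k ^ k            ≡⟨ *-comm (2 ^ m) (k ^ k) ⟩
  k ^ k * 2 ^ m            ∎
  where
  open ≤-Reasoning
  t = m / k
  m≤2ᵗk : m ≤ 2 ^ t * k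
  m≤2ᵗk = begin
    m              ≡⟨ m≡m%n+[m/n]*n m k ⟩
    m % k + t * k  ≤⟨ +-monoˡ-≤ (t * k) (<⇒≤ (m%n<n m k)) ⟩
    suc t * k      ≤⟨ *-monoˡ-≤ k (n<2^n t) ⟩
    2 ^ t * k      ∎

2^⌊log₂n⌋≤n : ∀ n .{{_ : NonZero n}} → 2 ^ ⌊log₂ n ⌋ ≤ n
2^⌊log₂n⌋≤n n = go ⌊log₂ n ⌋ n refl
  where
  go : ∀ k n .{{_ : NonZero n}} → ⌊log₂ n ⌋ ≡ k → 2 ^ k ≤ n
  go zero    n _ = >-nonZero⁻¹ n
  go (suc k) n@(suc (suc m)) log≡ = begin
    2 * 2 ^ k              ≤⟨ *-monoʳ-≤ 2 (go k h log-h≡k) ⟩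
    h + (h + 0)            ≡⟨ cong (h +_) (+-identityʳ h) ⟩
    h + h                  ≤⟨ +-monoʳ-≤ h (⌊n/2⌋≤⌈n/2⌉ n) ⟩
    h + ⌈ n /2⌉            ≡⟨ ⌊n/2⌋+⌈n/2⌉≡n n ⟩
    n                      ∎
    where
    open ≤-Reasoning
    h = ⌊ n /2⌋
    log-h≡k : ⌊log₂ h ⌋ ≡ k
    log-h≡k = trans (⌊log₂⌊n/2⌋⌋≡⌊log₂n⌋∸1 n) (cong (_∸ 1) log≡)

1≤⌊log₂n⌋ : ∀ {n} → 2 ≤ n → 1 ≤ ⌊log₂ n ⌋
1≤⌊log₂n⌋ = ⌊log₂⌋-mono-≤ {2}

module _ {n L : ℕ} (2ᴸ≤n : 2 ^ L ≤ n) where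

  private instance
    n≢0 : NonZero n
    n≢0 = >-nonZero (≤-trans (m^n>0 2 L) 2ᴸ≤n)

  L^k≤k^k*n : ∀ k .{{_ : NonZero k}} → L ^ k ≤ k ^ k * n
  L^k≤k^k*n k = ≤-trans (m^k≤k^k*2^m k L) (*-monoʳ-≤ (k ^ k) 2ᴸ≤n)

  heavy-bound-small : ∀ {h} → h ^ 4 ≤ n ^ 3 → h * L ^ 3 ≤ 1728 * n
  heavy-bound-small {h} h⁴≤n³ = ^-cancelˡ-≤ 4 (begin
    (h * L ^ 3) ^ 4          ≡⟨ ^-distrib-* h (L ^ 3) 4 ⟩
    h ^ 4 * (L ^ 3) ^ 4      ≡⟨ cong (h ^ 4 *_) (^-*-assoc L 3 4) ⟩
    h ^ 4 * L ^ 12           ≤⟨ *-mono-≤ h⁴≤n³ (L^k≤k^k*n 12) ⟩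
    n ^ 3 * (12 ^ 12 * n)    ≡⟨ solve 1 (λ n → n :^ 3 :* (con (12 ^ 12) :* n) := (con 1728 :* n) :^ 4)
                                        refl n ⟩
    (1728 * n) ^ 4           ∎)
    where open ≤-Reasoning

  -- Take p / q = 3L / 4 in ManyEdges: 2^{3L} ≤ n³ < w⁴, so its failure
  -- bounds the number of edges by 4⁶ w² / (3L)⁶.
  sparse-edges : ∀ {w m} → n ^ 3 < w ^ 4 → ¬ ManyEdges w m → (L * 3) ^ 6 * m ≤ w ^ 2 * 4 ^ 6
  sparse-edges {w} {m} n³<w⁴ ¬many = ≮⇒≥ λ lt → ¬many (L * 3 , 4 , s≤s z≤n , lt , 2^[3L]<w⁴)
    where
    open ≤-Reasoning
    2^[3L]<w⁴ : 2 ^ (L * 3) < w ^ 4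
    2^[3L]<w⁴ = begin-strict
      2 ^ (L * 3)   ≡⟨ ^-*-assoc 2 L 3 ⟨
      (2 ^ L) ^ 3   ≤⟨ ^-monoˡ-≤ 3 2ᴸ≤n ⟩
      n ^ 3         <⟨ n³<w⁴ ⟩
      w ^ 4         ∎

  heavy-bound-sparse : ∀ {w m h} → 1 ≤ L → n ^ 3 < w ^ 4 → w ≤ n → ¬ ManyEdges w m →
                       h * n ≤ m * L ^ 3 → h * L ^ 3 ≤ 4096 * n
  heavy-bound-sparse {w} {m} {h} 1≤L n³<w⁴ w≤n ¬many hn≤mT =
    *-cancelʳ-≤ (h * T) (4096 * n) T (*-cancelˡ-≤ n (begin
      n * (h * T * T)          ≡⟨ solve 3 (λ n h L → n :* (h :* L :^ 3 :* L :^ 3) := h :* n :* L :^ 6)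
                                          refl n h L ⟩
      h * n * L ^ 6            ≤⟨ *-monoˡ-≤ (L ^ 6) hn≤mT ⟩
      m * T * L ^ 6            ≤⟨ *-monoʳ-≤ (m * T) (^-monoˡ-≤ 6 (m≤m*n L 3)) ⟩
      m * T * (L * 3) ^ 6      ≡⟨ solve 3 (λ m T x → m :* T :* x := T :* (x :* m)) refl m T ((L * 3) ^ 6) ⟩
      T * ((L * 3) ^ 6 * m)    ≤⟨ *-monoʳ-≤ T (sparse-edges n³<w⁴ ¬many) ⟩
      T * (w ^ 2 * 4 ^ 6)      ≤⟨ *-monoʳ-≤ T (*-monoˡ-≤ (4 ^ 6) (^-monoˡ-≤ 2 w≤n)) ⟩
      T * (n ^ 2 * 4 ^ 6)      ≡⟨ solve 2 (λ T n → T :* (n :^ 2 :* con (4 ^ 6)) := n :* (con 4096 :* n :* T))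
                                          refl T n ⟩
      n * (4096 * n * T)       ∎))
    where
    open ≤-Reasoning
    T = L ^ 3
    instance
      T≢0 : NonZero T
      T≢0 = m^n≢0 L 3 {{>-nonZero 1≤L}}

  heavy-bound-halted : ∀ cmin {w m h} → 1 ≤ L → w ≤ n → h ≤ w → h * n ≤ m * L ^ 3 →
                       ¬ ((cmin < w) × (n ^ 3 < w ^ 4) × ManyEdges w m) →
                       h * L ^ 3 ≤ (cmin * 27 + 4096) * n
  heavy-bound-halted cmin {w} {m} {h} 1≤L w≤n h≤w hn≤mT halted with cmin <? w
  ... | no cmin≮w = begin
    h * L ^ 3              ≤⟨ *-mono-≤ (≤-trans h≤w (≮⇒≥ cmin≮w)) (L^k≤k^k*n 3) ⟩
    cmin * (27 * n)        ≡⟨ *-assoc cmin 27 n ⟨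
    cmin * 27 * n          ≤⟨ *-monoˡ-≤ n (m≤m+n (cmin * 27) 4096) ⟩
    (cmin * 27 + 4096) * n ∎
    where open ≤-Reasoning
  ... | yes cmin<w with n ^ 3 <? w ^ 4
  ...   | no n³≮w⁴ = ≤-trans
    (heavy-bound-small {h} (≤-trans (^-monoˡ-≤ 4 h≤w) (≮⇒≥ n³≮w⁴)))
    (*-monoˡ-≤ n (≤-trans (m≤m+n 1728 2368) (m≤n+m 4096 (cmin * 27))))
  ...   | yes n³<w⁴ = ≤-trans
    (heavy-bound-sparse {w} {m} {h} 1≤L n³<w⁴ w≤n (λ many → halted (cmin<w , n³<w⁴ , many))
                        hn≤mT)
    (*-monoˡ-≤ n (m≤n+m 4096 (cmin * 27)))

∧≡true⇒ˡ : ∀ {x y} → x ∧ y ≡ true → x ≡ true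
∧≡true⇒ˡ {true} _ = refl

sum-map-zero : ∀ {A : Set} (xs : List A) → sum (map (λ _ → 0) xs) ≡ 0
sum-map-zero []       = refl
sum-map-zero (_ ∷ xs) = sum-map-zero xs

∣tabulate∣≡sum : ∀ {k} (p : Fin k → Bool) →
                 ∣ Vec.tabulate p ∣ ≡ sum (List.tabulate (λ i → if p i then 1 else 0))
∣tabulate∣≡sum {zero}  p = refl
∣tabulate∣≡sum {suc k} p with p zero
... | true  = cong suc (∣tabulate∣≡sum (λ i → p (suc i)))
... | false = ∣tabulate∣≡sum (λ i → p (suc i))

-- Markov's inequality.
∣above∣*t≤sum*c : ∀ {k} t c (f : Fin k → ℕ) →
                  ∣ Vec.tabulate (λ i → t <ᵇ f i * c) ∣ * t ≤ sum (List.tabulate f) * c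
∣above∣*t≤sum*c {zero}  t c f = z≤n
∣above∣*t≤sum*c {suc k} t c f =
  cons (<ᵇ-reflects-< t (f zero * c)) (Vec.tabulate (λ i → t <ᵇ f (suc i) * c))
       (∣above∣*t≤sum*c t c (λ i → f (suc i)))
  where
  s = sum (List.tabulate (λ i → f (suc i)))
  cons : ∀ {above₀} → Reflects (t < f zero * c) above₀ → (v : Subset k) →
         ∣ v ∣ * t ≤ s * c → ∣ above₀ ∷ v ∣ * t ≤ (f zero + s) * c
  cons (ofʸ t<f₀c) _ ih =
    ≤-trans (+-mono-≤ (<⇒≤ t<f₀c) ih) (≤-reflexive (sym (*-distribʳ-+ c (f zero) s)))
  cons (ofⁿ _)     _ ih = ≤-trans ih (*-monoˡ-≤ c (m≤n+m s (f zero)))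

module HeavyLight {a b : ℕ} (E : BipEdges a b) (Ar : Subset a) (Br : Subset b) (n T : ℕ) where

  neighbours : Fin a → Subset b
  neighbours i = Vec.tabulate (λ j → lookup Br j ∧ E i j)

  neighbours⊆Br : ∀ i → neighbours i ⊆ Br
  neighbours⊆Br i {j} j∈ =
    lookup⇒[]= j Br (∧≡true⇒ˡ (trans (sym (lookup∘tabulate _ j)) ([]=⇒lookup j∈)))

  degree : Fin a → ℕ
  degree i = if lookup Ar i then ∣ neighbours i ∣ else 0

  degree≡∣neighbours∣ : ∀ {i} → i ∈ Ar → degree i ≡ ∣ neighbours i ∣
  degree≡∣neighbours∣ i∈Ar rewrite []=⇒lookup i∈Ar = refl

  edgeCount≡sum-degree : edgeCount E (Ar , Br) ≡ sum (List.tabulate degree)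
  edgeCount≡sum-degree = cong sum (trans (map-tabulate (λ i → i) row) (tabulate-cong row≡degree))
    where
    row : Fin a → ℕ
    row i = sum (map (λ j → if lookup Ar i ∧ lookup Br j ∧ E i j then 1 else 0) (allFin b))
    row≡degree : ∀ i → row i ≡ degree i
    row≡degree i with lookup Ar i
    ... | true  = trans (cong sum (map-tabulate (λ j → j) (λ j → if p j then 1 else 0)))
                        (sym (∣tabulate∣≡sum p))
      where
      p : Fin b → Bool
      p j = lookup Br j ∧ E i j
    ... | false = sum-map-zero (allFin b)

  heavy : Subset a
  heavy = Vec.tabulate (λ i → n <ᵇ degree i * T)

  heavy⊆Ar : heavy ⊆ Ar
  heavy⊆Ar {i} i∈heavy
    with lookup Ar i in Ar[i] | trans (sym (lookup∘tabulate _ i)) ([]=⇒lookup i∈heavy)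
  ... | true  | _  = lookup⇒[]= i Ar Ar[i]
  ... | false | ()

  ∣heavy∣*n≤edgeCount*T : ∣ heavy ∣ * n ≤ edgeCount E (Ar , Br) * T
  ∣heavy∣*n≤edgeCount*T =
    subst (λ m → ∣ heavy ∣ * n ≤ m * T) (sym edgeCount≡sum-degree) (∣above∣*t≤sum*c n T degree)

  light-neighbours : Fin a → Subset b
  light-neighbours i = if n <ᵇ degree i * T then ⊥ else neighbours i

  orientation : Vertex a b → VSet a b
  orientation (inj₁ i) = ⊥ , light-neighbours i
  orientation (inj₂ j) = heavy , ⊥

  orientation-covers : ∀ i j → j ∈ Br → E i j ≡ true →
                       (inj₁ i ∈V orientation (inj₂ j)) ⊎ (inj₂ j ∈V orientation (inj₁ i))
  orientation-covers i j j∈Br Eij with n <ᵇ degree i * T in heavy[i]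
  ... | true  = inj₁ (lookup⇒[]= i heavy (trans (lookup∘tabulate _ i) heavy[i]))
  ... | false = inj₂ (lookup⇒[]= j (neighbours i)
                        (trans (lookup∘tabulate _ j) (cong₂ _∧_ ([]=⇒lookup j∈Br) Eij)))

  orientation-⊆ : ∀ u → orientation u ⊆V (Ar , Br)
  orientation-⊆ (inj₁ i) = ⊥⊆ , light⊆Br
    where
    light⊆Br : light-neighbours i ⊆ Br
    light⊆Br with n <ᵇ degree i * T
    ... | true  = ⊥⊆
    ... | false = neighbours⊆Br i
  orientation-⊆ (inj₂ j) = heavy⊆Ar , ⊥⊆

  ∣orientation-inj₁∣*T≤n : ∀ i → i ∈ Ar → ∣ orientation (inj₁ i) ∣V * T ≤ n
  ∣orientation-inj₁∣*T≤n i i∈Ar rewrite ∣⊥∣≡0 a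
    with n <ᵇ degree i * T | <ᵇ-reflects-< n (degree i * T)
  ... | true  | _        = subst (λ k → k * T ≤ n) (sym (∣⊥∣≡0 b)) z≤n
  ... | false | ofⁿ n≮dT = subst (λ k → k * T ≤ n) (degree≡∣neighbours∣ i∈Ar) (≮⇒≥ n≮dT)

  ∣orientation-inj₂∣≡∣heavy∣ : ∀ j → ∣ orientation (inj₂ j) ∣V ≡ ∣ heavy ∣
  ∣orientation-inj₂∣≡∣heavy∣ j = trans (cong (∣ heavy ∣ +_) (∣⊥∣≡0 b)) (+-identityʳ ∣ heavy ∣)

run-halts : ∀ {a b cmin} {E : BipEdges a b} {s t} → Run cmin E s t → ¬ Continue cmin E t
run-halts (stop halted)  = halted
run-halts (step _ _ run) = run-halts run

lemma10 : (cmin : ℕ) →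
    Σ ℕ λ C → Σ ℕ λ n₀ →
      ∀ (a b : ℕ) → n₀ ≤ a + b →
      (E : BipEdges a b) (Arest : Subset a) (Brest : Subset b) →
      FindBicliques cmin E Arest Brest →
      Σ (Vertex a b → VSet a b) λ N →
        (∀ i j → i ∈ Arest → j ∈ Brest → E i j ≡ true →
           (inj₁ i ∈V N (inj₂ j)) ⊎ (inj₂ j ∈V N (inj₁ i)))
        × (∀ u → u ∈V (Arest , Brest) →
             (N u ⊆V (Arest , Brest))
             × (∣ N u ∣V * ⌊log₂ (a + b) ⌋ ^ 3 ≤ C * (a + b)))
lemma10 cmin = C , 2 , λ a b 2≤n E Ar Br run →
  let open HeavyLight E Ar Br (a + b) (⌊log₂ (a + b) ⌋ ^ 3)
      2ᴸ≤n = 2^⌊log₂n⌋≤n (a + b) {{>-nonZero (≤-trans (s≤s z≤n) 2≤n)}}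
      ∣heavy∣≤w = ≤-trans (p⊆q⇒∣p∣≤∣q∣ heavy⊆Ar) (m≤m+n ∣ Ar ∣ ∣ Br ∣)
      w≤n = +-mono-≤ (∣p∣≤n Ar) (∣p∣≤n Br)
  in orientation , (λ i j _ → orientation-covers i j) , λ where
    (inj₁ i) i∈Ar → orientation-⊆ (inj₁ i) ,
      ≤-trans (∣orientation-inj₁∣*T≤n i i∈Ar) (n≤C*n (a + b))
    (inj₂ j) _    → orientation-⊆ (inj₂ j) ,
      subst (λ h → h * ⌊log₂ (a + b) ⌋ ^ 3 ≤ C * (a + b)) (sym (∣orientation-inj₂∣≡∣heavy∣ j))
        (heavy-bound-halted 2ᴸ≤n cmin (1≤⌊log₂n⌋ 2≤n) w≤n ∣heavy∣≤w ∣heavy∣*n≤edgeCount*T (run-halts run))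
  where
  C = cmin * 27 + 4096
  n≤C*n : ∀ n → n ≤ C * n
  n≤C*n n = ≤-trans (m≤n*m n 4096) (*-monoˡ-≤ n (m≤n+m 4096 (cmin * 27)))
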